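{- Let $G$ be a convex bipartite graph satisfying Property A. Then $G$ has a Hamiltonian cycle.
   Context: All graphs are finite, simple, connected and unweighted. A convex bipartite graph is a bipartite graph $G$ with bipartition $(X,Y)$ together with an ordering $X=(x_1,\ldots,x_n)$ such that for every $y\in Y$ the neighborhood $N_G(y)$ consists of consecutive vertices of this ordering; $n=|X|$. For $1\le p<q\le n$ let $X_{p..q}=\{x_p,\ldots,x_q\}$, $N_G[X_{p..q}]=\{y\in Y : N_G(y)\subseteq X_{p..q}\}$ and $N'_G[X_{p..q}]=\{y\in Y : |N_G(y)\cap X_{p..q}|\ge 2\}$. $G$ satisfies Property A if: (1) for all $1\le p<q\le n$ with $(p,q)\neq(1,n)$, $|N_G[X_{p..q}]|\le q-p$; (2) for every integer $j\in\{1,\ldots,n-1\}$ and all indices with $1\le p_1<q_1\le p_2<q_2\le\cdots\le p_j<q_j\le n$, $\left|\bigcup_{i=1}^j N'_G[X_{p_i..q_i}]\right|\ge\sum_{i=1}^j (q_i-p_i)$; (3) $|N_G[X_{1..n}]|=|N'_G[X_{1..n}]|=n$. -}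

module Defs where

open import Data.Nat using (ℕ; zero; suc; _+_; _∸_; _≤_; _<_; _≤ᵇ_)
open import Data.Bool using (Bool; true; false; _∧_; _∨_; not)
open import Data.Fin using (Fin; toℕ; fromℕ; inject₁) renaming (_≤_ to _≤ᶠ_; zero to fzero; suc to fsuc)
open import Data.List using (List; []; _∷_; length; filterᵇ; allFin; map)
open import Data.Bool.ListAction using (all; any)
open import Data.Nat.ListAction using (sum)
open import Data.Sum using (_⊎_; inj₁; inj₂)
open import Data.Product using (Σ; _×_; _,_; ∃)
open import Data.Unit using (⊤)
open import Data.Empty using (⊥)
open import Relation.Binary.PropositionalEquality using (_≡_)
open import Relation.Nullary using (¬_)
open import Function.Definitions using (Injective; Surjective)

-- A simple bipartite graph with parts X = Fin n (ordered x₁,…,xₙ, where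
-- xᵢ is the element of Fin n with toℕ = i - 1) and Y = Fin m, given by
-- its biadjacency relation.

BipGraph : ℕ → ℕ → Set
BipGraph n m = Fin n → Fin m → Bool

module _ {n m : ℕ} (G : BipGraph n m) where

  Vertex : Set
  Vertex = Fin n ⊎ Fin m

  Adj : Vertex → Vertex → Set
  Adj (inj₁ x) (inj₂ y) = G x y ≡ true
  Adj (inj₂ y) (inj₁ x) = G x y ≡ true
  Adj (inj₁ _) (inj₁ _) = ⊥
  Adj (inj₂ _) (inj₂ _) = ⊥

  data Reach : Vertex → Vertex → Set where
    here : ∀ {u} → Reach u u
    step : ∀ {u v w} → Adj u v → Reach v w → Reach u w

  Connected : Set
  Connected = Vertex × (∀ u v → Reach u v)

  Convex : Set
  Convex = ∀ (y : Fin m) (i j k : Fin n) → i ≤ᶠ j → j ≤ᶠ k →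
           G i y ≡ true → G k y ≡ true → G j y ≡ true

  HamiltonianCycle : Set
  HamiltonianCycle =
    Σ ℕ λ k → Σ (Fin (suc k) → Vertex) λ c →
      Injective _≡_ _≡_ c × Surjective _≡_ _≡_ c × 3 ≤ suc k ×
      (∀ (i : Fin k) → Adj (c (inject₁ i)) (c (fsuc i))) ×
      Adj (c (fromℕ k)) (c fzero)

  -- x ∈ X_{p..q}  (1-based indices p, q)
  inRange : ℕ → ℕ → Fin n → Bool
  inRange p q x = (p ≤ᵇ suc (toℕ x)) ∧ (suc (toℕ x) ≤ᵇ q)

  -- y ∈ N_G[X_{p..q}]  :  N_G(y) ⊆ X_{p..q}
  inN : ℕ → ℕ → Fin m → Bool
  inN p q y = all (λ x → not (G x y) ∨ inRange p q x) (allFin n)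

  -- y ∈ N'_G[X_{p..q}]  :  |N_G(y) ∩ X_{p..q}| ≥ 2
  inN' : ℕ → ℕ → Fin m → Bool
  inN' p q y = 2 ≤ᵇ length (filterᵇ (λ x → G x y ∧ inRange p q x) (allFin n))

  countY : (Fin m → Bool) → ℕ
  countY f = length (filterᵇ f (allFin m))

  -- a list of intervals (p₁,q₁),…,(p_j,q_j) with
  -- 1 ≤ p₁ < q₁ ≤ p₂ < q₂ ≤ … ≤ p_j < q_j ≤ n
  Next : ℕ → List (ℕ × ℕ) → Set
  Next q [] = q ≤ n
  Next q ((p' , _) ∷ _) = q ≤ p'

  ChainFrom : List (ℕ × ℕ) → Set
  ChainFrom [] = ⊤
  ChainFrom ((p , q) ∷ rest) = p < q × Next q rest × ChainFrom rest

  Chain : List (ℕ × ℕ) → Set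
  Chain [] = ⊤
  Chain ((p , q) ∷ rest) = 1 ≤ p × ChainFrom ((p , q) ∷ rest)

  totalLength : List (ℕ × ℕ) → ℕ
  totalLength ivs = sum (map (λ { (p , q) → q ∸ p }) ivs)

  inUnionN' : List (ℕ × ℕ) → Fin m → Bool
  inUnionN' ivs y = any (λ { (p , q) → inN' p q y }) ivs

  PropertyA : Set
  PropertyA =
    (∀ p q → 1 ≤ p → p < q → q ≤ n → ¬ (p ≡ 1 × q ≡ n) →
       countY (inN p q) ≤ q ∸ p)
    × (∀ (ivs : List (ℕ × ℕ)) → 1 ≤ length ivs → length ivs ≤ n ∸ 1 →
       Chain ivs → totalLength ivs ≤ countY (inUnionN' ivs))
    × countY (inN 1 n) ≡ n × countY (inN' 1 n) ≡ n

module Submission where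

-- By Property A (3) every y ∈ Y has two distinct neighbours and |Y| = n;
-- by convexity N(y) is the interval of X between its least and greatest
-- neighbour.  Numbering X from 0, G is thus an interval bipartite graph
-- H_T[Y] (T = n - 1): y is adjacent to x iff lo y ≤ x ≤ hi y, lo y < hi y,
-- and Property A (1) becomes a Hall-type condition: a proper window p,…,q
-- contains at most q - p intervals.
--
-- The heart of the proof (module IntervalGraph) shows by induction on T
-- that such a graph has a Hamiltonian cycle through each edge T — y₀:
-- remove T together with an interval y₁ that reaches T and starts last;
-- the rest satisfies the Hall condition for T - 1, and T, y₁ are spliced
-- into a cycle of the smaller graph next to T - 1.

open import Defs
open import Level using (0ℓ)
open import Function using (id; _∘_; _∘′_; case_of_; Equivalence)
open import Data.Empty using (⊥; ⊥-elim)
open import Data.Product using (Σ-syntax; _×_; _,_; proj₁; proj₂)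
open import Data.Sum using (_⊎_; inj₁; inj₂; [_,_]′)
open import Data.Sum.Properties using (inj₁-injective; inj₂-injective)
open import Data.Bool using (true; false; T; not; _∧_; _∨_) renaming (_≟_ to _≟ᵇ_)
open import Data.Bool.Properties using (T-∧; T-≡)
open import Data.Nat using (ℕ; zero; suc; _+_; _∸_; _≤_; _<_; z≤n; s≤s) renaming (_≟_ to _≟ℕ_)
open import Data.Nat.Properties
open import Data.Nat.DivMod using (_mod_; m<n⇒m%n≡m)
open import Data.Fin using (Fin; toℕ; fromℕ; inject₁) renaming (zero to fzero; suc to fsuc)
open import Data.Fin.Properties using (toℕ-injective; toℕ<n; toℕ-fromℕ<)
open import Data.List using (List; []; _∷_; [_]; _++_; _∷ʳ_; length; map; filter; filterᵇ; reverse; lookup; downFrom; allFin)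
open import Data.List.Properties using (map-++; map-∘; map-downFrom; filter-all; filter-complete; filter-accept; unfold-reverse; length-++; length-map; length-downFrom; length-tabulate)
open import Data.List.Extrema.Nat using (argmin; argmax; argmin-all; argmax-all; f[argmin]≤f[xs]; f[xs]≤f[argmax])
open import Data.List.Membership.Propositional using (_∈_)
open import Data.List.Membership.Propositional.Properties using (∈-filter⁻; ∈-filter⁺; ∈-lookup; ∈-allFin; ∈-map⁺; ∈-map⁻; ∈-++⁺ˡ; ∈-++⁺ʳ; ∈-downFrom⁺)
open import Data.List.Relation.Unary.Any as Any using (here; there)
open import Data.List.Relation.Unary.Any.Properties using (lookup-index)
open import Data.List.Relation.Unary.All as All using (_∷_)
open import Data.List.Relation.Unary.All.Properties using (all-filter; all⁻)
open import Data.List.Relation.Unary.AllPairs using (_∷_)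
open import Data.List.Relation.Unary.Unique.Propositional using (Unique)
import Data.List.Relation.Unary.Unique.Propositional.Properties as Unique
open import Data.List.Relation.Binary.Permutation.Propositional using (_↭_; prep; swap; ↭-refl; ↭-sym; ↭-trans; ↭⇒↭ₛ; module PermutationReasoning)
open import Data.List.Relation.Binary.Permutation.Propositional.Properties using (↭-length; filter-↭; ∈-resp-↭; ↭-reverse; ++⁺ˡ; map⁺; shift; ∷↭∷ʳ)
import Data.List.Relation.Binary.Permutation.Setoid.Properties as PermutationSetoid
open import Relation.Binary.PropositionalEquality using (_≡_; _≢_; refl; sym; trans; cong; cong₂; subst; subst₂; module ≡-Reasoning)
open import Relation.Binary.PropositionalEquality.Properties using () renaming (setoid to ≡-setoid)
open import Relation.Nullary using (¬_; yes; no)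
open import Relation.Nullary.Decidable using (T?; ¬?; _×-dec_; _⊎-dec_)
open import Relation.Unary using (Pred; Decidable)

count : {A : Set} {P : Pred A 0ℓ} → Decidable P → List A → ℕ
count P? xs = length (filter P? xs)

module _ {A : Set} {P : Pred A 0ℓ} (P? : Decidable P) where

  count-↭ : ∀ {xs ys} → xs ↭ ys → count P? xs ≡ count P? ys
  count-↭ p = ↭-length (filter-↭ P? p)

  count-accept : ∀ {x} xs → P x → count P? (x ∷ xs) ≡ suc (count P? xs)
  count-accept xs px = cong length (filter-accept P? px)

  count-∷ : ∀ x xs → count P? xs ≤ count P? (x ∷ xs)
  count-∷ x xs with P? x
  ... | yes _ = n≤1+n _
  ... | no _  = ≤-refl

  count-member : ∀ {x xs} → x ∈ xs → P x → 1 ≤ count P? xs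
  count-member {xs = y ∷ xs} (here refl) px rewrite count-accept xs px = s≤s z≤n
  count-member {xs = y ∷ xs} (there x∈) px = ≤-trans (count-member x∈ px) (count-∷ y xs)

  count-witness : ∀ xs → 1 ≤ count P? xs → Σ[ x ∈ A ] x ∈ xs × P x
  count-witness xs pos with filter P? xs in eq
  count-witness xs () | []
  count-witness xs pos | x ∷ _ = x , ∈-filter⁻ P? (subst (x ∈_) (sym eq) (here refl))

  count-complement : ∀ xs → count P? xs + count (λ x → ¬? (P? x)) xs ≡ length xs
  count-complement [] = refl
  count-complement (x ∷ xs) with P? x
  ... | yes _ = cong suc (count-complement xs)
  ... | no _  = trans (+-suc _ _) (cong suc (count-complement xs))

count-mono : {A : Set} {P Q : Pred A 0ℓ} (P? : Decidable P) (Q? : Decidable Q) →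
  ∀ xs → (∀ {x} → x ∈ xs → P x → Q x) → count P? xs ≤ count Q? xs
count-mono P? Q? [] P⇒Q = z≤n
count-mono P? Q? (x ∷ xs) P⇒Q with P? x | Q? x
... | yes px | yes _  = s≤s (count-mono P? Q? xs (P⇒Q ∘′ there))
... | yes px | no ¬qx = ⊥-elim (¬qx (P⇒Q (here refl) px))
... | no _   | yes _  = m≤n⇒m≤1+n (count-mono P? Q? xs (P⇒Q ∘′ there))
... | no _   | no _   = count-mono P? Q? xs (P⇒Q ∘′ there)

extract : {A : Set} {x : A} {xs : List A} → x ∈ xs → Σ[ xs' ∈ List A ] xs ↭ x ∷ xs'
extract (here refl) = _ , ↭-refl
extract {xs = y ∷ _} (there x∈) with xs' , xs↭ ← extract x∈ = y ∷ xs' , ↭-trans (prep y xs↭) (swap y _ ↭-refl)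

infixr 5 _∷_

data Path {V : Set} (R : V → V → Set) : V → V → List V → Set where
  single : ∀ u → Path R u u [ u ]
  _∷_    : ∀ {u v w vs} → R u v → Path R v w vs → Path R u w (u ∷ vs)

module _ {V : Set} {R : V → V → Set} where

  infixl 5 _▷_
  _▷_ : ∀ {u w x vs} → Path R u w vs → R w x → Path R u x (vs ∷ʳ x)
  single u ▷ r = r ∷ single _
  (s ∷ p)  ▷ r = s ∷ (p ▷ r)

  reversePath : (∀ {x y} → R x y → R y x) → ∀ {u w vs} → Path R u w vs → Path R w u (reverse vs)
  reversePath sym-R (single u) = single u
  reversePath sym-R {u} {vs = _ ∷ vs} (r ∷ p) =
    subst (Path R _ u) (sym (unfold-reverse u vs)) (reversePath sym-R p ▷ sym-R r)

  mapPath : {W : Set} {S : W → W → Set} (f : V → W) → (∀ {x y} → R x y → S (f x) (f y)) →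
    ∀ {u w vs} → Path R u w vs → Path S (f u) (f w) (map f vs)
  mapPath f f-hom (single u) = single (f u)
  mapPath f f-hom (r ∷ p)    = f-hom r ∷ mapPath f f-hom p

  path-first : ∀ {u w x vs} → Path R u w (x ∷ vs) → x ≡ u
  path-first (single u) = refl
  path-first (_ ∷ _)    = refl

  path-last : ∀ {u w x vs} → Path R u w (x ∷ vs) → lookup (x ∷ vs) (fromℕ (length vs)) ≡ w
  path-last (single u)         = refl
  path-last (_ ∷ p@(single _)) = path-last p
  path-last (_ ∷ p@(_ ∷ _))    = path-last p

  path-step : ∀ {u w x vs} → Path R u w (x ∷ vs) →
    (i : Fin (length vs)) → R (lookup (x ∷ vs) (inject₁ i)) (lookup (x ∷ vs) (fsuc i))
  path-step (single _) ()
  path-step (r ∷ single _) fzero    = r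
  path-step (r ∷ (s ∷ p))  fzero    = r
  path-step (r ∷ (s ∷ p))  (fsuc i) = path-step (s ∷ p) i

lookup-injective : {A : Set} {xs : List A} → Unique xs →
  ∀ {i j} → lookup xs i ≡ lookup xs j → i ≡ j
lookup-injective {xs = _ ∷ _} _ {fzero} {fzero} _ = refl
lookup-injective {xs = _ ∷ _} (x∉ ∷ _) {fzero} {fsuc j} eq = ⊥-elim (All.lookup x∉ (∈-lookup j) eq)
lookup-injective {xs = _ ∷ _} (x∉ ∷ _) {fsuc i} {fzero} eq = ⊥-elim (All.lookup x∉ (∈-lookup i) (sym eq))
lookup-injective {xs = _ ∷ _} (_ ∷ u) {fsuc i} {fsuc j} eq = cong fsuc (lookup-injective u eq)

closeHamiltonianPath : ∀ {n m} (G : BipGraph n m) {u w vs} → Path (Adj G) u w vs →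
  Unique vs → (∀ v → v ∈ vs) → 3 ≤ length vs → Adj G w u → HamiltonianCycle G
closeHamiltonianPath G {vs = x ∷ vs} p unique complete three w~u =
  length vs , lookup (x ∷ vs) , lookup-injective unique ,
  (λ v → Any.index (complete v) , λ { refl → sym (lookup-index (complete v)) }) ,
  three , path-step p ,
  subst₂ (Adj G) (sym (path-last p)) (sym (path-first p)) w~u

-- Interval bipartite graphs.  Each y ∈ Y carries an interval [a y, b y]
-- of naturals with a y < b y; the graph H_T[L] has X-vertices 0,…,T,
-- Y-vertices the members of L, and x ∼ y iff x lies in y's interval.

module IntervalGraph {Y : Set} (a b : Y → ℕ) (a<b : ∀ y → a y < b y) where

  infix 4 _∼_
  _∼_ : ℕ → Y → Set
  x ∼ y = a y ≤ x × x ≤ b y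

  V : Set
  V = ℕ ⊎ Y

  Edge : V → V → Set
  Edge (inj₁ x) (inj₂ y) = x ∼ y
  Edge (inj₂ y) (inj₁ x) = x ∼ y
  Edge (inj₁ _) (inj₁ _) = ⊥
  Edge (inj₂ _) (inj₂ _) = ⊥

  Edge-sym : ∀ {u v} → Edge u v → Edge v u
  Edge-sym {inj₁ _} {inj₂ _} e = e
  Edge-sym {inj₂ _} {inj₁ _} e = e

  vertices : ℕ → List Y → List V
  vertices T L = map inj₁ (downFrom (suc T)) ++ map inj₂ L

  length-vertices : ∀ T L → length (vertices T L) ≡ suc T + length L
  length-vertices T L = begin
    length (X ++ map inj₂ L)              ≡⟨ length-++ X ⟩
    length X + length (map inj₂ L)        ≡⟨ cong₂ _+_ (trans (length-map inj₁ (downFrom (suc T))) (length-downFrom (suc T)))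
                                                        (length-map inj₂ L) ⟩
    suc T + length L                      ∎
    where
      open ≡-Reasoning
      X = map inj₁ (downFrom (suc T))

  top-adjacent : ∀ {T y} → a y < suc T → suc T ≤ b y → T ∼ y × suc T ∼ y
  top-adjacent a<1+T 1+T≤b = (≤-pred a<1+T , ≤-trans (n≤1+n _) 1+T≤b) , (<⇒≤ a<1+T , 1+T≤b)

  -- A Hamiltonian cycle of H_T[L] in which the two neighbours of T are
  -- y and z: a Hamiltonian path of H_T[L] − T from y to z.
  record Cycle (T : ℕ) (L : List Y) (y z : Y) : Set where
    field
      route    : List V
      path     : Path Edge (inj₂ y) (inj₂ z) route
      spanning : inj₁ T ∷ route ↭ vertices T L
      T∼y      : T ∼ y
      T∼z      : T ∼ z

  reverseCycle : ∀ {T L y z} → Cycle T L y z → Cycle T L z y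
  reverseCycle c = record
    { route    = reverse route
    ; path     = reversePath Edge-sym path
    ; spanning = ↭-trans (prep _ (↭-reverse route)) spanning
    ; T∼y      = T∼z
    ; T∼z      = T∼y
    }
    where open Cycle c

  vertices-step : ∀ {T L L' y₁} → L ↭ y₁ ∷ L' →
    vertices T L ↭ inj₂ y₁ ∷ vertices T L'
  vertices-step {T} {L} {L'} {y₁} L↭ = begin
    X ++ map inj₂ L            ↭⟨ ++⁺ˡ X (map⁺ inj₂ L↭) ⟩
    X ++ inj₂ y₁ ∷ map inj₂ L' ↭⟨ shift (inj₂ y₁) X (map inj₂ L') ⟩
    inj₂ y₁ ∷ X ++ map inj₂ L' ∎
    where
      open PermutationReasoning
      X = map inj₁ (downFrom (suc T))

  -- Insert the new top vertex T + 1 and y₁ into a cycle of H_T[L']: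
  -- the closing edge z — T becomes z — T — y₁ — T + 1.
  extendCycle : ∀ {T L L' y z y₁} → L ↭ y₁ ∷ L' → T ∼ y₁ → suc T ∼ y₁ → suc T ∼ y →
    Cycle T L' y z → Cycle (suc T) L y y₁
  extendCycle {T} {L} {L'} {y} {z} {y₁} L↭ T∼y₁ 1+T∼y₁ 1+T∼y c = record
    { route    = route ∷ʳ inj₁ T ∷ʳ inj₂ y₁
    ; path     = path ▷ T∼z ▷ T∼y₁
    ; spanning = prep (inj₁ (suc T)) spans
    ; T∼y      = 1+T∼y
    ; T∼z      = 1+T∼y₁
    }
    where
      open Cycle c
      open PermutationReasoning
      spans : route ∷ʳ inj₁ T ∷ʳ inj₂ y₁ ↭ vertices T L
      spans = begin
        route ∷ʳ inj₁ T ∷ʳ inj₂ y₁   ↭⟨ ↭-sym (∷↭∷ʳ (inj₂ y₁) _) ⟩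
        inj₂ y₁ ∷ (route ∷ʳ inj₁ T)  ↭⟨ prep (inj₂ y₁) (↭-sym (∷↭∷ʳ (inj₁ T) route)) ⟩
        inj₂ y₁ ∷ inj₁ T ∷ route     ↭⟨ prep (inj₂ y₁) spanning ⟩
        inj₂ y₁ ∷ vertices T L'      ↭⟨ ↭-sym (vertices-step L↭) ⟩
        vertices T L                 ∎

  -- Inside T p q y: the part of y's interval within 0,…,T lies in p,…,q
  Inside : ℕ → ℕ → ℕ → Y → Set
  Inside T p q y = p ≤ a y × (b y ≤ q ⊎ T ≤ q)

  inside? : ∀ T p q → Decidable (Inside T p q)
  inside? T p q y = (p ≤? a y) ×-dec ((b y ≤? q) ⊎-dec (T ≤? q))

  reaches? : ∀ T → Decidable (λ y → T ≤ b y)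
  reaches? T y = T ≤? b y

  -- The Hall-type condition on H_T[L] that drives the induction: as many
  -- Y- as X-vertices, every interval meets 0,…,T in at least two points,
  -- and a proper window p,…,q contains at most q - p intervals.
  record Hall (T : ℕ) (L : List Y) : Set where
    field
      size  : length L ≡ suc T
      below : ∀ {y} → y ∈ L → a y < T
      bound : ∀ p q → p < q → q ≤ T → ¬ (p ≡ 0 × q ≡ T) → count (inside? T p q) L ≤ q ∸ p

  -- For T ≥ 2 at least two intervals reach T: those that do not reach it
  -- lie in the window 0,…,T - 1, which holds at most T - 1 of them.
  twoReachTop : ∀ {T L} → Hall (suc (suc T)) L → 2 ≤ count (reaches? (suc (suc T))) L
  twoReachTop {T} {L} H = +-cancelʳ-≤ (suc T) 2 _ (begin
    2 + suc T                      ≡⟨ sym (trans (count-complement (reaches? _) L) size) ⟩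
    count (reaches? _) L + misses  ≤⟨ +-monoʳ-≤ (count (reaches? _) L) misses≤ ⟩
    count (reaches? _) L + suc T   ∎)
    where
      open Hall H
      open ≤-Reasoning
      misses = count (λ y → ¬? (reaches? (suc (suc T)) y)) L
      misses≤ : misses ≤ suc T
      misses≤ = ≤-trans (count-mono _ (inside? (suc (suc T)) 0 (suc T)) L
                           (λ _ miss → z≤n , inj₁ (≤-pred (≰⇒> miss))))
                        (bound 0 (suc T) (s≤s z≤n) (n≤1+n _) λ { (_ , ()) })

  -- Among the members of L whose interval reaches T, one whose interval
  -- starts last; it is the Y-vertex removed together with T.
  record TopChoice (T : ℕ) (L : List Y) : Set where
    field
      y₁      : Y
      member  : y₁ ∈ L
      reaches : T ≤ b y₁
      latest  : ∀ {z} → z ∈ L → T ≤ b z → a z ≤ a y₁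

  topChoice : ∀ {T L w} → w ∈ L → T ≤ b w → TopChoice T L
  topChoice {T} {L} {w} w∈ w-reaches = record
    { y₁      = y₁
    ; member  = proj₁ y₁-cand
    ; reaches = proj₂ y₁-cand
    ; latest  = λ z∈ z-reaches →
        All.lookup (f[xs]≤f[argmax] w candidates) (∈-filter⁺ (reaches? T) z∈ z-reaches)
    }
    where
      candidates = filter (reaches? T) L
      y₁ = argmax a w candidates
      y₁-cand : y₁ ∈ L × T ≤ b y₁
      y₁-cand = argmax-all a (w∈ , w-reaches) (All.tabulate (∈-filter⁻ (reaches? T)))

  -- Deleting the top vertex T₂ = T + 2 and the top choice y₁ from H_T₂[L]
  -- leaves H_T₁[L'], T₁ = T + 1, which again satisfies the Hall condition.
  module Removal {T : ℕ} {L L' : List Y} (H : Hall (suc (suc T)) L)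
                 (t : TopChoice (suc (suc T)) L) (L↭ : L ↭ TopChoice.y₁ t ∷ L') where

    open TopChoice t
    open ≤-Reasoning

    private
      T₁ T₂ : ℕ
      T₁ = suc T
      T₂ = suc T₁

      from-L' : ∀ {y} → y ∈ L' → y ∈ L
      from-L' y∈ = ∈-resp-↭ (↭-sym L↭) (there y∈)

      count-drop : ∀ {P : Pred Y 0ℓ} (P? : Decidable P) → count P? L' ≤ count P? L
      count-drop P? = subst (count P? L' ≤_) (sym (count-↭ P? L↭)) (count-∷ P? y₁ L')

      count-drop-y₁ : ∀ {P : Pred Y 0ℓ} (P? : Decidable P) → P y₁ → count P? L ≡ suc (count P? L')
      count-drop-y₁ P? p = trans (count-↭ P? L↭) (count-accept P? L' p)

      -- If some y ∈ L' started at T₁, then y and y₁ would be two intervals in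
      -- the window T₁,…,T₂, which holds at most one.
      below′ : ∀ {y} → y ∈ L' → a y < T₁
      below′ {y} y∈ with a y <? T₁
      ... | yes a<T₁ = a<T₁
      ... | no  a≮T₁ = ⊥-elim (1+n≰n (begin
            2                      ≤⟨ s≤s (count-member W y∈ y-in) ⟩
            suc (count W L')       ≡⟨ sym (count-drop-y₁ W y₁-in) ⟩
            count W L              ≤⟨ Hall.bound H T₁ T₂ ≤-refl ≤-refl (λ { (() , _) }) ⟩
            T₂ ∸ T₁                ≡⟨ m+n∸n≡m 1 T₁ ⟩
            1                      ∎))
        where
          W = inside? T₂ T₁ T₂
          T₁≤a : T₁ ≤ a y
          T₁≤a = ≮⇒≥ a≮T₁
          y-in : Inside T₂ T₁ T₂ y
          y-in = T₁≤a , inj₂ ≤-refl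
          y₁-in : Inside T₂ T₁ T₂ y₁
          y₁-in = ≤-trans T₁≤a (latest (from-L' y∈) (≤-trans (s≤s T₁≤a) (a<b y))) , inj₂ ≤-refl

      bound-low : ∀ p q → p < q → q ≤ T₁ →
        (∀ {y} → y ∈ L' → Inside T₁ p q y → b y < T₂) → count (inside? T₁ p q) L' ≤ q ∸ p
      bound-low p q p<q q≤T₁ stops = begin
        count (inside? T₁ p q) L'  ≤⟨ count-mono (inside? T₁ p q) (inside? T₂ p q) L' lift ⟩
        count (inside? T₂ p q) L'  ≤⟨ count-drop (inside? T₂ p q) ⟩
        count (inside? T₂ p q) L   ≤⟨ Hall.bound H p q p<q (m≤n⇒m≤1+n q≤T₁) not-top ⟩
        q ∸ p                      ∎
        where
          not-top : ¬ (p ≡ 0 × q ≡ T₂)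
          not-top (_ , q≡T₂) = 1+n≰n (subst (_≤ T₁) q≡T₂ q≤T₁)
          lift : ∀ {y} → y ∈ L' → Inside T₁ p q y → Inside T₂ p q y
          lift _  (p≤a , inj₁ b≤q)      = p≤a , inj₁ b≤q
          lift y∈ in₁@(p≤a , inj₂ T₁≤q) = p≤a , inj₁ (≤-trans (≤-pred (stops y∈ in₁)) T₁≤q)

      -- the window p,…,T₁ with p ≤ a y₁: together with y₁ its intervals lie
      -- in the window p,…,T₂ of H_T₂[L]
      bound-top : ∀ p → p < T₁ → p ≢ 0 → p ≤ a y₁ → count (inside? T₁ p T₁) L' ≤ T₁ ∸ p
      bound-top p p<T₁ p≢0 p≤a₁ = ≤-pred (begin
        suc (count (inside? T₁ p T₁) L')  ≤⟨ s≤s (count-mono (inside? T₁ p T₁) W L' lift) ⟩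
        suc (count W L')                  ≡⟨ sym (count-drop-y₁ W (p≤a₁ , inj₂ ≤-refl)) ⟩
        count W L                         ≤⟨ Hall.bound H p T₂ (m<n⇒m<1+n p<T₁) ≤-refl (p≢0 ∘′ proj₁) ⟩
        T₂ ∸ p                            ≡⟨ +-∸-assoc 1 (<⇒≤ p<T₁) ⟩
        suc (T₁ ∸ p)                      ∎)
        where
          W = inside? T₂ p T₂
          lift : ∀ {y} → y ∈ L' → Inside T₁ p T₁ y → Inside T₂ p T₂ y
          lift _ (p≤a , _) = p≤a , inj₂ ≤-refl

      -- either the window is p,…,T₁ with p ≤ a y₁, or no interval it
      -- contains reaches T₂ (such an interval would start before y₁)
      bound′ : ∀ p q → p < q → q ≤ T₁ → ¬ (p ≡ 0 × q ≡ T₁) → count (inside? T₁ p q) L' ≤ q ∸ p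
      bound′ p q p<q q≤T₁ proper with q ≟ℕ T₁ | p ≤? a y₁
      ... | yes refl | yes p≤a₁ = bound-top p p<q (λ p≡0 → proper (p≡0 , refl)) p≤a₁
      ... | yes refl | no p≰a₁  = bound-low p q p<q q≤T₁ λ y∈ (p≤a , _) →
            ≰⇒> λ T₂≤b → p≰a₁ (≤-trans p≤a (latest (from-L' y∈) T₂≤b))
      ... | no q≢T₁  | _        = bound-low p q p<q q≤T₁ λ where
            _ (_ , inj₁ b≤q)  → s≤s (≤-trans b≤q q≤T₁)
            _ (_ , inj₂ T₁≤q) → ⊥-elim (q≢T₁ (≤-antisym q≤T₁ T₁≤q))

    hall′ : Hall T₁ L'
    hall′ = record
      { size  = suc-injective (trans (sym (↭-length L↭)) (Hall.size H))
      ; below = below′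
      ; bound = bound′
      }

  baseCycle : ∀ {u v} → Hall 1 (u ∷ v ∷ []) → Cycle 1 (u ∷ v ∷ []) u v
  baseCycle {u} {v} H = record
    { route    = inj₂ u ∷ inj₁ 0 ∷ inj₂ v ∷ []
    ; path     = proj₁ u-adj ∷ proj₁ v-adj ∷ single (inj₂ v)
    ; spanning = prep (inj₁ 1) (swap (inj₂ u) (inj₁ 0) ↭-refl)
    ; T∼y      = proj₂ u-adj
    ; T∼z      = proj₂ v-adj
    }
    where
      bottom-adjacent : ∀ {y} → y ∈ u ∷ v ∷ [] → 0 ∼ y × 1 ∼ y
      bottom-adjacent {y} y∈ = top-adjacent (Hall.below H y∈) (≤-trans (s≤s z≤n) (a<b y))
      u-adj = bottom-adjacent (here refl)
      v-adj = bottom-adjacent (there (here refl))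

  -- In the step,
  -- remove T and a top choice y₁, close a cycle of the smaller graph
  -- through a vertex y ≠ y₁ reaching T (y₀ itself unless y₀ = y₁), and
  -- insert T and y₁ next to it.
  cycleThrough : ∀ T {L y₀} → Hall (suc T) L → y₀ ∈ L → suc T ≤ b y₀ →
    Σ[ z ∈ Y ] Cycle (suc T) L y₀ z
  cycleThrough zero {[]}              H () _
  cycleThrough zero {_ ∷ []}          H _  _ with () ← Hall.size H
  cycleThrough zero {_ ∷ _ ∷ _ ∷ _}   H _  _ with () ← Hall.size H
  cycleThrough zero {u ∷ v ∷ []}      H (here refl)         _ = v , baseCycle H
  cycleThrough zero {u ∷ v ∷ []}      H (there (here refl)) _ = u , reverseCycle (baseCycle H)
  cycleThrough (suc T) {L} {y₀} H y₀∈ y₀-reaches = through-y₀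
    where
      t : TopChoice (suc (suc T)) L
      t = topChoice y₀∈ y₀-reaches
      open TopChoice t
      L' = proj₁ (extract member)
      L↭ : L ↭ y₁ ∷ L'
      L↭ = proj₂ (extract member)
      H' = Removal.hall′ H t L↭

      adjacent : ∀ {y} → y ∈ L → suc (suc T) ≤ b y → suc T ∼ y × suc (suc T) ∼ y
      adjacent y∈ = top-adjacent (Hall.below H y∈)

      insertTop : ∀ {y} → y ∈ L' → suc (suc T) ≤ b y → Cycle (suc (suc T)) L y y₁
      insertTop {y} y∈' y-reaches =
        extendCycle L↭ (proj₁ y₁-adj) (proj₂ y₁-adj) (proj₂ (adjacent y∈ y-reaches))
          (proj₂ (cycleThrough T H' y∈' (<⇒≤ y-reaches)))
        where
          y∈ = ∈-resp-↭ (↭-sym L↭) (there y∈')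
          y₁-adj = adjacent member reaches

      -- y₁ is only one of the at least two intervals reaching T + 2
      other-reaches : 1 ≤ count (reaches? (suc (suc T))) L'
      other-reaches = ≤-pred (subst (2 ≤_) L-count (twoReachTop H))
        where
          L-count : count (reaches? _) L ≡ suc (count (reaches? _) L')
          L-count = trans (count-↭ (reaches? _) L↭) (count-accept (reaches? _) L' reaches)

      through-y₀ : Σ[ z ∈ Y ] Cycle (suc (suc T)) L y₀ z
      through-y₀ with ∈-resp-↭ L↭ y₀∈
      ... | there y₀∈' = y₁ , insertTop y₀∈' y₀-reaches
      ... | here y₀≡y₁ with y , y∈' , y-reaches ← count-witness (reaches? _) L' other-reaches =
            y , subst (λ w → Cycle _ L w y) (sym y₀≡y₁) (reverseCycle (insertTop y∈' y-reaches))

  someReachTop : ∀ T {L} → Hall (suc T) L → Σ[ y ∈ Y ] y ∈ L × suc T ≤ b y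
  someReachTop zero {[]}    H with () ← Hall.size H
  someReachTop zero {u ∷ _} H = u , here refl , ≤-trans (s≤s z≤n) (a<b u)
  someReachTop (suc T) {L}  H = count-witness (reaches? _) L (≤-trans (s≤s z≤n) (twoReachTop H))

  hamiltonianIntervals : ∀ T {L} → Hall (suc T) L → Σ[ y ∈ Y ] Σ[ z ∈ Y ] Cycle (suc T) L y z
  hamiltonianIntervals T H with y , y∈ , y-reaches ← someReachTop T H =
    y , cycleThrough T H y∈ y-reaches

record TwoNeighbours {n m : ℕ} (G : BipGraph n m) (y : Fin m) : Set where
  field
    u v   : Fin n
    u≢v   : u ≢ v
    u-adj : G u y ≡ true
    v-adj : G v y ≡ true

module ConvexIntervals {n m : ℕ} (G : BipGraph n m) (convex : Convex G)
                       (two : ∀ y → TwoNeighbours G y) where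

  neighbours : Fin m → List (Fin n)
  neighbours y = filter (λ x → G x y ≟ᵇ true) (allFin n)

  first last : Fin m → Fin n
  first y = argmin toℕ (TwoNeighbours.u (two y)) (neighbours y)
  last  y = argmax toℕ (TwoNeighbours.u (two y)) (neighbours y)

  lo hi : Fin m → ℕ
  lo y = toℕ (first y)
  hi y = toℕ (last y)

  -- N(y) is exactly the interval lo y,…,hi y: the extreme neighbours bound
  -- all others, and convexity fills the gap between them
  adjacent⇒between : ∀ {x y} → G x y ≡ true → lo y ≤ toℕ x × toℕ x ≤ hi y
  adjacent⇒between {x} {y} x~y =
    All.lookup (f[argmin]≤f[xs] _ (neighbours y)) x∈ , All.lookup (f[xs]≤f[argmax] _ (neighbours y)) x∈
    where x∈ = ∈-filter⁺ (λ x → G x y ≟ᵇ true) (∈-allFin x) x~y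

  between⇒adjacent : ∀ {x y} → lo y ≤ toℕ x → toℕ x ≤ hi y → G x y ≡ true
  between⇒adjacent {x} {y} lo≤x x≤hi = convex y (first y) x (last y) lo≤x x≤hi
    (argmin-all toℕ u-adj (all-filter (λ x → G x y ≟ᵇ true) (allFin n)))
    (argmax-all toℕ u-adj (all-filter (λ x → G x y ≟ᵇ true) (allFin n)))
    where open TwoNeighbours (two y)

  -- if hi y ≤ lo y, the two distinct neighbours of y would share a position
  lo<hi : ∀ y → lo y < hi y
  lo<hi y = ≰⇒> λ hi≤lo → u≢v (toℕ-injective (trans (pinned u-adj hi≤lo) (sym (pinned v-adj hi≤lo))))
    where
      open TwoNeighbours (two y)
      pinned : ∀ {x} → G x y ≡ true → hi y ≤ lo y → toℕ x ≡ lo y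
      pinned x~y hi≤lo with lo≤x , x≤hi ← adjacent⇒between x~y = ≤-antisym (≤-trans x≤hi hi≤lo) lo≤x

  hi<n : ∀ y → hi y < n
  hi<n y = toℕ<n (last y)

module _ {n m : ℕ} (G : BipGraph n m) where

  neighbourhood-within : ∀ {p q y} →
    (∀ {x} → G x y ≡ true → p ≤ suc (toℕ x) × suc (toℕ x) ≤ q) → T (inN G p q y)
  neighbourhood-within {p} {q} {y} within =
    all⁻ (λ x → not (G x y) ∨ inRange G p q x) {xs = allFin n} (All.tabulate λ {x} _ → in-range x)
    where
      in-range : ∀ x → T (not (G x y) ∨ inRange G p q x)
      in-range x with G x y in x~y
      ... | false = _
      ... | true  with p≤ , ≤q ← within x~y = Equivalence.from T-∧ (≤⇒≤ᵇ p≤ , ≤⇒≤ᵇ ≤q)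

  -- (3): every y lies in N_G[X_{1..n}], so |Y| = |N_G[X_{1..n}]| = n
  m≡n : PropertyA G → m ≡ n
  m≡n (_ , _ , |N|≡n , _) = begin
    m                     ≡⟨ sym (length-tabulate {n = m} id) ⟩
    length (allFin m)     ≡⟨ cong length (sym all-counted) ⟩
    countY G (inN G 1 n)  ≡⟨ |N|≡n ⟩
    n                     ∎
    where
      open ≡-Reasoning
      whole : ∀ y → T (inN G 1 n y)
      whole y = neighbourhood-within λ {x} _ → s≤s z≤n , toℕ<n x
      all-counted : filter (T? ∘ inN G 1 n) (allFin m) ≡ allFin m
      all-counted = filter-all (T? ∘ inN G 1 n) (All.tabulate λ {y} _ → whole y)

  -- (3): |N'_G[X_{1..n}]| = n = |Y|, so N'_G[X_{1..n}] is all of Y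
  everyInN' : PropertyA G → ∀ y → T (inN' G 1 n y)
  everyInN' A@(_ , _ , _ , |N'|≡n) y =
    proj₂ (∈-filter⁻ (T? ∘ inN' G 1 n) {xs = allFin m} (subst (y ∈_) (sym all-counted) (∈-allFin y)))
    where
      all-counted : filter (T? ∘ inN' G 1 n) (allFin m) ≡ allFin m
      all-counted = filter-complete (T? ∘ inN' G 1 n) (trans |N'|≡n (trans (sym (m≡n A)) (sym (length-tabulate {n = m} id))))

  counted : Fin m → List (Fin n)
  counted y = filterᵇ (λ x → G x y ∧ inRange G 1 n x) (allFin n)

  twoNeighbours : PropertyA G → ∀ y → TwoNeighbours G y
  twoNeighbours A y with counted y in nbrs≡ | ≤ᵇ⇒≤ 2 (length (counted y)) (everyInN' A y)
  ... | []        | ()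
  ... | _ ∷ []    | s≤s ()
  ... | u ∷ v ∷ _ | _ = record
    { u = u ; v = v ; u≢v = u≢v ; u-adj = adjacent (here refl) ; v-adj = adjacent (there (here refl)) }
    where
      unique : Unique (u ∷ v ∷ _)
      unique = subst Unique nbrs≡ (Unique.filter⁺ _ (Unique.allFin⁺ n))
      u≢v : u ≢ v
      u≢v with (u≢v ∷ _) ∷ _ ← unique = u≢v
      adjacent : ∀ {x} → x ∈ u ∷ v ∷ _ → G x y ≡ true
      adjacent x∈ with _ , counted-x ← ∈-filter⁻ (T? ∘ λ x → G x y ∧ inRange G 1 n x) {xs = allFin n}
                                          (subst (_ ∈_) (sym nbrs≡) x∈) =
        Equivalence.to T-≡ (proj₁ (Equivalence.to T-∧ counted-x))

module Assembly (k m : ℕ) (G : BipGraph (suc (suc k)) m) (convex : Convex G) (A : PropertyA G) where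

  n top : ℕ
  n   = suc (suc k)
  top = suc k

  open ConvexIntervals G convex (twoNeighbours G A)
  open IntervalGraph lo hi lo<hi public

  -- Property A (1), for the windows X_{p+1..q+1}, bounds the intervals inside p,…,q
  hall : Hall top (allFin m)
  hall = record
    { size  = trans (length-tabulate {n = m} id) (m≡n G A)
    ; below = λ {y} _ → <-≤-trans (lo<hi y) (≤-pred (hi<n y))
    ; bound = λ p q p<q q≤top proper →
        ≤-trans (count-mono (inside? top p q) (T? ∘ inN G (suc p) (suc q)) (allFin m) (λ _ → inside⇒inN))
                (proj₁ A (suc p) (suc q) (s≤s z≤n) (s≤s p<q) (s≤s q≤top)
                   λ (1+p≡1 , 1+q≡n) → proper (suc-injective 1+p≡1 , suc-injective 1+q≡n))
    }
    where
      inside⇒inN : ∀ {p q y} → Inside top p q y → T (inN G (suc p) (suc q) y)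
      inside⇒inN {p} {q} {y} (p≤lo , hi≤q⊎top≤q) = neighbourhood-within G λ x~y →
        let lo≤x , x≤hi = adjacent⇒between x~y in
        s≤s (≤-trans p≤lo lo≤x) ,
        s≤s (≤-trans x≤hi ([ id , ≤-trans (≤-pred (hi<n y)) ]′ hi≤q⊎top≤q))

  embed : V → Vertex G
  embed (inj₁ x) = inj₁ (x mod n)
  embed (inj₂ y) = inj₂ y

  toℕ-mod : ∀ {x} → x < n → toℕ (x mod n) ≡ x
  toℕ-mod x<n = trans (toℕ-fromℕ< _) (m<n⇒m%n≡m x<n)

  embed-adjacent : ∀ {x y} → x ∼ y → G (x mod n) y ≡ true
  embed-adjacent {x} {y} (lo≤x , x≤hi) =
    between⇒adjacent (subst (lo y ≤_) (sym x≡) lo≤x) (subst (_≤ hi y) (sym x≡) x≤hi)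
    where x≡ = toℕ-mod (≤-<-trans x≤hi (hi<n y))

  embed-edge : ∀ {u v} → Edge u v → Adj G (embed u) (embed v)
  embed-edge {inj₁ _} {inj₂ _} x∼y = embed-adjacent x∼y
  embed-edge {inj₂ _} {inj₁ _} x∼y = embed-adjacent x∼y

  Xs : List (Fin n)
  Xs = map (_mod n) (downFrom n)

  Xs-unique : Unique Xs
  Xs-unique = subst Unique (sym (map-downFrom (_mod n) n))
    (Unique.applyDownFrom⁺₁ (_mod n) n λ j<i i<n i≡j →
      <⇒≢ j<i (sym (trans (sym (toℕ-mod i<n)) (trans (cong toℕ i≡j) (toℕ-mod (<-trans j<i i<n))))))

  Xs-complete : ∀ i → i ∈ Xs
  Xs-complete i = subst (_∈ Xs) (toℕ-injective (toℕ-mod (toℕ<n i))) (∈-map⁺ (_mod n) (∈-downFrom⁺ (toℕ<n i)))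

  allVertices : List (Vertex G)
  allVertices = map inj₁ Xs ++ map inj₂ (allFin m)

  allVertices-unique : Unique allVertices
  allVertices-unique = Unique.++⁺ (Unique.map⁺ inj₁-injective Xs-unique) (Unique.map⁺ inj₂-injective (Unique.allFin⁺ m))
    λ (v∈₁ , v∈₂) → case (∈-map⁻ inj₁ v∈₁ , ∈-map⁻ inj₂ v∈₂) of λ { ((_ , _ , refl) , (_ , _ , ())) }

  allVertices-complete : ∀ v → v ∈ allVertices
  allVertices-complete (inj₁ i) = ∈-++⁺ˡ (∈-map⁺ inj₁ (Xs-complete i))
  allVertices-complete (inj₂ y) = ∈-++⁺ʳ (map inj₁ Xs) (∈-map⁺ inj₂ (∈-allFin y))

  embed-vertices : map embed (vertices top (allFin m)) ≡ allVertices
  embed-vertices = begin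
    map embed (map inj₁ (downFrom n) ++ map inj₂ Ys)            ≡⟨ map-++ embed (map inj₁ (downFrom n)) _ ⟩
    map embed (map inj₁ (downFrom n)) ++ map embed (map inj₂ Ys) ≡⟨ cong₂ _++_ (sym (map-∘ (downFrom n))) (sym (map-∘ Ys)) ⟩
    map (inj₁ ∘ (_mod n)) (downFrom n) ++ map inj₂ Ys           ≡⟨ cong (_++ map inj₂ Ys) (map-∘ (downFrom n)) ⟩
    allVertices                                                 ∎
    where
      open ≡-Reasoning
      Ys = allFin m

  -- A Hamiltonian cycle of H_top[Y] becomes one of G: prepend top to its
  -- route, embed, and close with the edge z — top.
  transferCycle : ∀ {y z} → Cycle top (allFin m) y z → HamiltonianCycle G
  transferCycle c = closeHamiltonianPath G (mapPath embed embed-edge (T∼y ∷ path))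
                                         unique complete three (embed-adjacent T∼z)
    where
      open Cycle c
      image : map embed (inj₁ top ∷ route) ↭ allVertices
      image = subst (map embed (inj₁ top ∷ route) ↭_) embed-vertices (map⁺ embed spanning)

      unique : Unique (map embed (inj₁ top ∷ route))
      unique = PermutationSetoid.Unique-resp-↭ (≡-setoid _) (↭⇒↭ₛ (↭-sym image)) allVertices-unique

      complete : ∀ v → v ∈ map embed (inj₁ top ∷ route)
      complete v = ∈-resp-↭ (↭-sym image) (allVertices-complete v)

      size : length (map embed (inj₁ top ∷ route)) ≡ n + suc top
      size = begin
        length (map embed (inj₁ top ∷ route)) ≡⟨ length-map embed (inj₁ top ∷ route) ⟩
        length (inj₁ top ∷ route)              ≡⟨ ↭-length spanning ⟩
        length (vertices top (allFin m))       ≡⟨ length-vertices top (allFin m) ⟩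
        n + length (allFin m)                  ≡⟨ cong (n +_) (Hall.size hall) ⟩
        n + suc top                            ∎
        where open ≡-Reasoning

      three : 3 ≤ length (map embed (inj₁ top ∷ route))
      three = subst (3 ≤_) (sym size) (+-mono-≤ {2} {n} {1} {suc top} (s≤s (s≤s z≤n)) (s≤s z≤n))

-- The theorem.  Connectivity is only needed to know that G has a vertex;
-- by Property A (3) some y then has two distinct neighbours, so n ≥ 2.

distinct⇒2≤n : ∀ {n} {u v : Fin n} → u ≢ v → 2 ≤ n
distinct⇒2≤n {zero}        {()}
distinct⇒2≤n {suc zero}    {fzero} {fzero} u≢v = ⊥-elim (u≢v refl)
distinct⇒2≤n {suc (suc _)} _       = s≤s (s≤s z≤n)

two≤n : ∀ {n m} (G : BipGraph n m) → Connected G → PropertyA G → 2 ≤ n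
two≤n {m = m} G (v , _) A = distinct⇒2≤n (TwoNeighbours.u≢v (twoNeighbours G A (some-y v)))
  where
    -- |Y| = n, so a vertex of either side provides an element of Y
    some-y : Vertex G → Fin m
    some-y (inj₁ x) = subst Fin (sym (m≡n G A)) x
    some-y (inj₂ y) = y

theorem3 : (n m : ℕ) (G : BipGraph n m) → Connected G → Convex G →
  PropertyA G → HamiltonianCycle G
theorem3 0             m G connected convex A with () ← two≤n G connected A
theorem3 1             m G connected convex A with s≤s () ← two≤n G connected A
theorem3 (suc (suc k)) m G connected convex A =
  let open Assembly k m G convex A
      (_ , _ , cycle) = hamiltonianIntervals k hall
  in transferCycle cycle
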